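{- Let $D$ be a digraph and let $k$ be an integer with $dc(D)\le k\le dG(D)$. Then there is a digrundy coloring of $D$ using exactly $k$ colors.
   Context: All digraphs are finite, without loops; symmetric arcs (2-cycles) are permitted. A (vertex) coloring of a digraph $D$ is acyclic if each chromatic class induces a subdigraph with no directed cycle. The dichromatic number $dc(D)$ is the smallest $k$ such that $D$ has an acyclic coloring with $k$ colors. Greedy coloring with respect to an ordering $v_1,\dots,v_n$ of $V(D)$: $v_1$ gets color $1$; if $v_1,\dots,v_j$ have been colored with colors $1,\dots,t-1$ and $V_1,\dots,V_{t-1}$ are the current chromatic classes, then $v_{j+1}$ gets the smallest $i$ such that $V_i\cup\{v_{j+1}\}$ induces an acyclic subdigraph, and gets the new color $t$ if there is no such $i$. A digrundy coloring of $D$ is a coloring of $D$ that arises as the greedy coloring with respect to some ordering of $V(D)$ (equivalently, an acyclic coloring with colors $1,\dots,k$ such that for all $i<j$ and every vertex $v$ of color $j$, the set consisting of $v$ and the vertices of color $i$ induces a subdigraph containing a directed cycle). The digrundy number $dG(D)$ is the largest number of colors in a greedy coloring of $D$ over all orderings of $V(D)$. -}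

module Defs where

open import Data.Nat using (ℕ; zero; suc; _≤_; _<_)
open import Data.Fin using (Fin; zero; suc; inject₁; fromℕ; toℕ)
open import Data.Bool using (Bool; true; false)
open import Data.Product using (Σ; ∃; _×_; _,_)
open import Data.Sum using (_⊎_)
open import Relation.Binary.PropositionalEquality using (_≡_; _≢_)
open import Relation.Nullary using (¬_)
open import Function.Definitions using (Injective; Surjective)

-- A finite digraph on vertex set Fin n; arc u → v iff arc u v ≡ true.
-- Symmetric arcs (2-cycles) are allowed; loops are forbidden.
record Digraph : Set where
  field
    n        : ℕ
    arc      : Fin n → Fin n → Bool
    loopless : ∀ v → arc v v ≡ false
open Digraph public

Arc : (D : Digraph) → Fin (n D) → Fin (n D) → Set
Arc D u v = arc D u v ≡ true

-- A directed cycle of D all of whose vertices satisfy S: pairwise distinct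
-- vertices w 0, …, w (m+1)  (length m+2 ≥ 2) with arcs w i → w (i+1) and
-- w (m+1) → w 0.  "S induces a subdigraph containing a directed cycle".
record CycleIn (D : Digraph) (S : Fin (n D) → Set) : Set where
  field
    m      : ℕ
    w      : Fin (suc (suc m)) → Fin (n D)
    inj    : Injective _≡_ _≡_ w
    inS    : ∀ i → S (w i)
    step   : ∀ (i : Fin (suc m)) → Arc D (w (inject₁ i)) (w (suc i))
    close  : Arc D (w (fromℕ (suc m))) (w zero)

Acyclic : (D : Digraph) → (Fin (n D) → Set) → Set
Acyclic D S = ¬ CycleIn D S

IsAcyclicColoring : (D : Digraph) (k : ℕ) → (Fin (n D) → Fin k) → Set
IsAcyclicColoring D k c = ∀ (i : Fin k) → Acyclic D (λ v → c v ≡ i)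

IsDichromaticNumber : Digraph → ℕ → Set
IsDichromaticNumber D d =
  (Σ (Fin (n D) → Fin d) λ c → IsAcyclicColoring D d c) ×
  (∀ k (c : Fin (n D) → Fin k) → IsAcyclicColoring D k c → d ≤ k)

-- An ordering of V(D): pos v is the position of v; injective (hence bijective).
-- c is the greedy coloring w.r.t. the ordering (colors 0,…,k-1 stand for 1,…,k):
-- for each vertex v, adding v to the vertices preceding v that have colour c v
-- keeps that class acyclic, and for every smaller colour i, adding v to the
-- preceding vertices of colour i creates a directed cycle.  (Such an i-class
-- is then nonempty, so "new colour" is exactly the next unused one.)
IsGreedyColoring : (D : Digraph) (pos : Fin (n D) → Fin (n D)) (k : ℕ)
                   → (Fin (n D) → Fin k) → Set
IsGreedyColoring D pos k c =
  ∀ v →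
    Acyclic D (λ u → u ≡ v ⊎ (toℕ (pos u) < toℕ (pos v) × c u ≡ c v)) ×
    (∀ (i : Fin k) → toℕ i < toℕ (c v) →
       CycleIn D (λ u → u ≡ v ⊎ (toℕ (pos u) < toℕ (pos v) × c u ≡ i)))

DigrundyColoring : Digraph → ℕ → Set
DigrundyColoring D k =
  Σ (Fin (n D) → Fin (n D)) λ pos →
  Σ (Fin (n D) → Fin k) λ c →
    Injective _≡_ _≡_ pos × IsGreedyColoring D pos k c × Surjective _≡_ _≡_ c

IsDigrundyNumber : Digraph → ℕ → Set
IsDigrundyNumber D g =
  DigrundyColoring D g × (∀ k → DigrundyColoring D k → k ≤ g)

-- Start from an ordering listing the classes of an
-- optimal acyclic coloring one after the other: its greedy coloring uses at most dc(D) ≤ k colors.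
-- Move towards the ordering π of a greedy coloring with dG(D) ≥ k colors, fixing one more vertex
-- of π per step: at step m the first m vertices of π keep their place, the next vertex x of π comes
-- right after them, and the remaining vertices follow grouped by their current color class, the
-- class of b = cπ(x) last. The new greedy coloring agrees with π on the fixed vertices, and every
-- other vertex gets at most its old color, or at most k - 1 if its old color was b. Hence colors
-- never exceed k - 1, while k - 1 is reached at the latest when the ordering has become π; since
-- greedy colors form an initial segment of ℕ, that coloring uses exactly k colors.

module Submission where

open import Data.Bool using (true)
open import Data.Bool.Properties using (T-≡) renaming (_≟_ to _≟ᵇ_)
open import Data.Empty using (⊥-elim)
open import Data.Fin using (Fin; zero; suc; toℕ; fromℕ<; inject₁; fromℕ)
open import Data.Fin.Properties
  using (any?; all?; toℕ-fromℕ<; toℕ-injective; toℕ<n; ¬Fin0; injective⇒≤)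
  renaming (_≟_ to _≟ᶠ_)
open import Data.Fin.Subset using (Subset; ∣_∣; _∈_; _⊂_) renaming (_⊆_ to _⊆ˢ_)
open import Data.Fin.Subset.Properties using (∈⊤; ∣⊤∣≡n; p⊆q⇒∣p∣≤∣q∣; p⊂q⇒∣p∣<∣q∣)
open import Data.Nat using (ℕ; zero; suc; _+_; _*_; _≤_; _<_; s≤s; s≤s⁻¹; _<?_)
open import Data.Nat.Induction using (<-wellFounded; <-rec)
open import Data.Nat.Properties
  using ( <⇒≤; m≤n+m; m≤m+n; ≤-refl; ≤-reflexive; ≤-trans; ≤-antisym; <-trans; <-irrefl; <-asym
        ; ≮⇒≥; ≰⇒>; ≤∧≢⇒<; ≤∧≮⇒≡; ≤-<-trans; <-≤-trans; <-cmp; n<1+n; n≤1+n; n≤0⇒n≡0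
        ; suc-injective; +-comm; +-monoʳ-<; *-monoˡ-≤; +-cancelˡ-≡; +-cancelˡ-<; anyUpTo?
        ; module ≤-Reasoning )
  renaming (_≟_ to _≟ⁿ_)
open import Data.Product using (Σ; ∃; _×_; _,_; proj₁; proj₂)
open import Data.Sum using (_⊎_; inj₁; inj₂; [_,_]′)
open import Data.Vec using (tabulate)
open import Data.Vec.Functional using (_∷_; head; tail; updateAt)
open import Data.Vec.Functional.Properties using (∷-cong; updateAt-updates; updateAt-minimal)
open import Data.Vec.Properties using (lookup∘tabulate; []=⇒lookup; lookup⇒[]=)
open import Function using (_∘_; id; case_of_)
open import Function.Bundles using (_⇔_; mk⇔; module Equivalence)
open import Function.Definitions using (Injective; Surjective)
open import Induction.WellFounded using (module All)
open import Level using (0ℓ)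
open import Relation.Binary.Construct.On as On using ()
open import Relation.Binary.Definitions using (tri<; tri≈; tri>)
open import Relation.Binary.PropositionalEquality
  using (_≡_; _≢_; refl; sym; trans; cong; subst; subst₂; _≗_; module ≡-Reasoning)
open import Relation.Nullary using (¬_; Dec; yes; no)
open import Relation.Nullary.Decidable
  using (_×-dec_; _→-dec_; _⊎-dec_; ¬?; decidable-stable; ⌊_⌋; toWitness; fromWitness)
open import Relation.Unary using (Decidable; _⊆_)

open import Defs

open Equivalence using (to; from)

anyVector? : ∀ k {N} (P : (Fin k → Fin N) → Set) → (∀ {f g} → f ≗ g → P f → P g) →
             Decidable P → Dec (∃ P)
anyVector? zero P resp P? with P? (λ ())
... | yes p = yes (_ , p)
... | no ¬p = no λ (f , pf) → ¬p (resp (λ ()) pf)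
anyVector? (suc k) P resp P?
  with any? (λ a → anyVector? k (P ∘ (a ∷_)) (λ e → resp (∷-cong refl e)) (P? ∘ (a ∷_)))
... | yes (a , f , p) = yes (_ , p)
... | no ¬p = no λ (f , pf) → ¬p (head f , tail f , resp (∷-cong refl λ _ → refl) pf)

minimal : ∀ {P : ℕ → Set} → Decidable P → ∀ p → P p →
          ∃ λ j → P j × j ≤ p × (∀ i → i < j → ¬ P i)
minimal {P} P? = <-rec (λ p → P p → ∃ λ j → P j × j ≤ p × (∀ i → i < j → ¬ P i))
  λ p rec Pp → case anyUpTo? P? p of λ where
    (yes (i , i<p , Pi)) → let (j , Pj , j≤i , least) = rec i<p Pi
                           in j , Pj , ≤-trans j≤i (<⇒≤ i<p) , least
    (no none) → p , Pp , ≤-refl , λ i i<p Pi → none (i , i<p , Pi)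

bounded : ∀ {k} (f : Fin k → ℕ) → ∃ λ R → ∀ i → f i < R
bounded {zero} f = 0 , λ ()
bounded {suc k} f with bounded (f ∘ suc)
... | R , f∘suc<R = R + suc (f zero) , λ where
  zero → m≤n+m (suc (f zero)) R
  (suc i) → ≤-trans (f∘suc<R i) (m≤m+n R _)

lex-≤ : ∀ {R} a b {x y} → y < R → a * R + x ≤ b * R + y → a ≤ b
lex-≤ {R} a b {x} {y} y<R ax≤by = ≮⇒≥ λ b<a → <-irrefl refl (begin-strict
  a * R + x     ≤⟨ ax≤by ⟩
  b * R + y     <⟨ +-monoʳ-< (b * R) y<R ⟩
  b * R + R     ≡⟨ +-comm (b * R) R ⟩
  suc b * R     ≤⟨ *-monoˡ-≤ R b<a ⟩
  a * R         ≤⟨ m≤m+n (a * R) x ⟩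
  a * R + x     ∎)
  where open ≤-Reasoning

lex-injective : ∀ {R} a b {x y} → x < R → y < R → a * R + x ≡ b * R + y → a ≡ b × x ≡ y
lex-injective {R} a b {x} {y} x<R y<R e =
  a≡b , +-cancelˡ-≡ (a * R) x y (subst (λ c → a * R + x ≡ c * R + y) (sym a≡b) e)
  where
  a≡b : a ≡ b
  a≡b = ≤-antisym (lex-≤ a b y<R (≤-reflexive e)) (lex-≤ b a x<R (≤-reflexive (sym e)))

compress : ∀ {N} (r : Fin N → ℕ) → Injective _≡_ _≡_ r →
           Σ (Fin N → Fin N) λ pos →
             Injective _≡_ _≡_ pos × (∀ {u v} → toℕ (pos u) < toℕ (pos v) ⇔ r u < r v)
compress {N} r r-inj = pos , pos-injective , λ {u v} → pos-order {u} {v}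
  where
  preceding : Fin N → Subset N
  preceding v = tabulate λ u → ⌊ r u <? r v ⌋

  ∈-preceding : ∀ {u v} → u ∈ preceding v ⇔ r u < r v
  ∈-preceding {u} {v} = mk⇔
    (λ u∈ → toWitness {a? = r u <? r v}
              (from T-≡ (trans (sym (lookup∘tabulate _ u)) ([]=⇒lookup u∈))))
    (λ ru<rv → lookup⇒[]= u _ (trans (lookup∘tabulate _ u) (to T-≡ (fromWitness ru<rv))))

  preceding-mono : ∀ {u v} → r u ≤ r v → preceding u ⊆ˢ preceding v
  preceding-mono ru≤rv w∈ = from ∈-preceding (<-≤-trans (to ∈-preceding w∈) ru≤rv)

  preceding-strict : ∀ {u v} → r u < r v → preceding u ⊂ preceding v
  preceding-strict ru<rv = preceding-mono (<⇒≤ ru<rv) , _ , from ∈-preceding ru<rv ,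
                           <-irrefl refl ∘ to ∈-preceding

  pos : Fin N → Fin N
  pos v = fromℕ< (subst (∣ preceding v ∣ <_) (∣⊤∣≡n N)
                   (p⊂q⇒∣p∣<∣q∣ ((λ _ → ∈⊤) , v , ∈⊤ , <-irrefl refl ∘ to ∈-preceding)))

  toℕ-pos : ∀ v → toℕ (pos v) ≡ ∣ preceding v ∣
  toℕ-pos v = toℕ-fromℕ< _

  pos-order : ∀ {u v} → toℕ (pos u) < toℕ (pos v) ⇔ r u < r v
  pos-order {u} {v} = mk⇔
    (λ pu<pv → ≰⇒> λ rv≤ru → <-irrefl refl (<-≤-trans (subst₂ _<_ (toℕ-pos u) (toℕ-pos v) pu<pv)
                                                       (p⊆q⇒∣p∣≤∣q∣ (preceding-mono rv≤ru))))
    (λ ru<rv → subst₂ _<_ (sym (toℕ-pos u)) (sym (toℕ-pos v)) (p⊂q⇒∣p∣<∣q∣ (preceding-strict ru<rv)))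

  pos-injective : Injective _≡_ _≡_ pos
  pos-injective {u} {v} pu≡pv with <-cmp (r u) (r v)
  ... | tri< ru<rv _ _ = ⊥-elim (<-irrefl (cong toℕ pu≡pv) (from pos-order ru<rv))
  ... | tri≈ _ ru≡rv _ = r-inj ru≡rv
  ... | tri> _ _ rv<ru = ⊥-elim (<-irrefl (cong toℕ (sym pu≡pv)) (from pos-order rv<ru))

module Cycles (D : Digraph) where

  V : Set
  V = Fin (n D)

  CycleIn-mono : ∀ {S S′ : V → Set} → S ⊆ S′ → CycleIn D S → CycleIn D S′
  CycleIn-mono S⊆S′ C = record
    { m = m ; w = w ; inj = inj ; inS = S⊆S′ ∘ inS ; step = step ; close = close }
    where open CycleIn C

  CycleIn-other : ∀ {S} → CycleIn D S → ∀ v → ∃ λ u → S u × u ≢ v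
  CycleIn-other C v with CycleIn.w C zero ≟ᶠ v | CycleIn.w C (suc zero) ≟ᶠ v
  ... | no w₀≢v | _ = _ , CycleIn.inS C zero , w₀≢v
  ... | yes _ | no w₁≢v = _ , CycleIn.inS C (suc zero) , w₁≢v
  ... | yes w₀≡v | yes w₁≡v with CycleIn.inj C (trans w₀≡v (sym w₁≡v))
  ...   | ()

  private
    IsCycle : (S : V → Set) (m : ℕ) → (Fin (suc (suc m)) → V) → Set
    IsCycle S m w = (∀ i j → w i ≡ w j → i ≡ j) × (∀ i → S (w i)) ×
                    (∀ i → Arc D (w (inject₁ i)) (w (suc i))) × Arc D (w (fromℕ (suc m))) (w zero)

    IsCycle-resp : ∀ {S m f g} → f ≗ g → IsCycle S m f → IsCycle S m g
    IsCycle-resp {S} {m} f≗g (inj , inS , step , close) =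
      (λ i j e → inj i j (trans (f≗g i) (trans e (sym (f≗g j))))) ,
      (λ i → subst S (f≗g i) (inS i)) ,
      (λ i → subst₂ (Arc D) (f≗g (inject₁ i)) (f≗g (suc i)) (step i)) ,
      subst₂ (Arc D) (f≗g (fromℕ (suc m))) (f≗g zero) close

    isCycle? : ∀ {S} → Decidable S → ∀ m → Decidable (IsCycle S m)
    isCycle? S? m w =
      all? (λ i → all? λ j → (w i ≟ᶠ w j) →-dec (i ≟ᶠ j)) ×-dec all? (S? ∘ w) ×-dec
      all? (λ i → arc? (w (inject₁ i)) (w (suc i))) ×-dec arc? (w (fromℕ (suc m))) (w zero)
      where
      arc? : ∀ u v → Dec (Arc D u v)
      arc? u v = arc D u v ≟ᵇ true

  cycleIn? : ∀ {S} → Decidable S → Dec (CycleIn D S)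
  cycleIn? {S} S? with any? (λ (m : Fin (n D)) →
                      anyVector? _ (IsCycle S (toℕ m)) (IsCycle-resp {S}) (isCycle? S? (toℕ m)))
  ... | yes (_ , w , inj , inS , step , close) = yes record
    { w = w ; inj = λ {i j} → inj i j ; inS = inS ; step = step ; close = close }
  ... | no ¬cycle = no λ C → ¬cycle (fromℕ< (short C) ,
                      subst (λ m → ∃ (IsCycle S m)) (sym (toℕ-fromℕ< (short C))) (asIsCycle C))
    where
    short : (C : CycleIn D S) → CycleIn.m C < n D
    short C = <⇒≤ (injective⇒≤ (CycleIn.inj C))
    asIsCycle : (C : CycleIn D S) → ∃ (IsCycle S (CycleIn.m C))
    asIsCycle C = w , (λ i j → inj) , inS , step , close
      where open CycleIn C

module Greedy (D : Digraph) where
  open Cycles D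

  Before : {C : Set} → (V → ℕ) → (V → C) → V → C → V → Set
  Before r c v j u = u ≡ v ⊎ (r u < r v × c u ≡ j)

  before? : (r c : V → ℕ) → ∀ v j → Decidable (Before r c v j)
  before? r c v j u = (u ≟ᶠ v) ⊎-dec ((r u <? r v) ×-dec (c u ≟ⁿ j))

  Before-mono : ∀ {C C′ : Set} {r r′ : V → ℕ} {c : V → C} {c′ : V → C′} {v j j′} →
                (∀ {u} → u ≢ v → r u < r v → c u ≡ j → r′ u < r′ v × c′ u ≡ j′) →
                Before r c v j ⊆ Before r′ c′ v j′
  Before-mono h (inj₁ u≡v) = inj₁ u≡v
  Before-mono {v = v} h {u} (inj₂ (ru<rv , cu≡j)) with u ≟ᶠ v
  ... | yes u≡v = inj₁ u≡v
  ... | no u≢v = inj₂ (h u≢v ru<rv cu≡j)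

  GreedyAt : (V → ℕ) → (V → ℕ) → V → Set
  GreedyAt r c v = Acyclic D (Before r c v (c v)) × (∀ j → j < c v → CycleIn D (Before r c v j))

  IsGreedy : (V → ℕ) → (V → ℕ) → Set
  IsGreedy r c = ∀ v → GreedyAt r c v

  greedy-least : ∀ {r c v j} → GreedyAt r c v → Acyclic D (Before r c v j) → c v ≤ j
  greedy-least (_ , blocked) acyclic = ≮⇒≥ (acyclic ∘ blocked _)

  GreedyAt-cong : ∀ {r c c′ v} → c′ v ≡ c v → (∀ {u} → r u < r v → c′ u ≡ c u) →
                  GreedyAt r c v → GreedyAt r c′ v
  GreedyAt-cong c′v≡cv same (acyclic , blocked) =
    acyclic ∘ CycleIn-mono (Before-mono λ _ ru<rv c′u≡c′v →
      ru<rv , trans (sym (same ru<rv)) (trans c′u≡c′v c′v≡cv)) ,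
    λ j j<c′v → CycleIn-mono (Before-mono λ _ ru<rv cu≡j → ru<rv , trans (same ru<rv) cu≡j)
                  (blocked j (subst (j <_) c′v≡cv j<c′v))

  rank-induction : (r : V → ℕ) (P : V → Set) → (∀ v → (∀ {u} → r u < r v → P u) → P v) →
                   ∀ v → P v
  rank-induction r P = All.wfRec (On.wellFounded r <-wellFounded) 0ℓ P

  private
    GreedyBelow : (V → ℕ) → ℕ → (V → ℕ) → Set
    GreedyBelow r p c = ∀ {u} → r u < p → GreedyAt r c u × c u ≤ r u

    greedyBelow-extend : ∀ {r p c v} → Injective _≡_ _≡_ r → GreedyBelow r p c → r v ≡ p →
                         ∃ (GreedyBelow r (suc p))
    greedyBelow-extend {r} {p} {c} {v} r-inj below rv≡p = c′ , below′
      where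
      unused : Acyclic D (Before r c v p)
      unused C with CycleIn-other C v
      ... | _ , inj₁ u≡v , u≢v = u≢v u≡v
      ... | u , inj₂ (ru<rv , cu≡p) , _ = <-irrefl cu≡p (≤-<-trans (proj₂ (below ru<p)) ru<p)
        where
        ru<p : r u < p
        ru<p = subst (r u <_) rv≡p ru<rv

      least : ∃ λ j → Acyclic D (Before r c v j) × j ≤ p ×
                      (∀ i → i < j → ¬ Acyclic D (Before r c v i))
      least = minimal (λ j → ¬? (cycleIn? (before? r c v j))) p unused

      j : ℕ
      j = proj₁ least
      j-acyclic : Acyclic D (Before r c v j)
      j-acyclic = proj₁ (proj₂ least)
      j≤p : j ≤ p
      j≤p = proj₁ (proj₂ (proj₂ least))
      j-least : ∀ i → i < j → ¬ Acyclic D (Before r c v i)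
      j-least = proj₂ (proj₂ (proj₂ least))

      c′ : V → ℕ
      c′ = updateAt c v λ _ → j
      c′v≡j : c′ v ≡ j
      c′v≡j = updateAt-updates v c
      c′≡c : ∀ {u} → u ≢ v → c′ u ≡ c u
      c′≡c u≢v = updateAt-minimal _ v c u≢v

      greedy-v : GreedyAt r c′ v
      greedy-v =
        j-acyclic ∘ CycleIn-mono (Before-mono λ u≢v ru<rv c′u≡c′v →
          ru<rv , trans (sym (c′≡c u≢v)) (trans c′u≡c′v c′v≡j)) ,
        λ i i<c′v → CycleIn-mono (Before-mono λ u≢v ru<rv cu≡i → ru<rv , trans (c′≡c u≢v) cu≡i)
                      (decidable-stable (cycleIn? (before? r c v i))
                        (j-least i (subst (i <_) c′v≡j i<c′v)))

      below′ : GreedyBelow r (suc p) c′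
      below′ {u} ru<1+p with u ≟ᶠ v
      ... | yes refl = greedy-v , subst₂ _≤_ (sym c′v≡j) (sym rv≡p) j≤p
      ... | no u≢v = GreedyAt-cong (c′≡c u≢v) c′≡c-before (proj₁ (below ru<p)) ,
                     subst (_≤ r u) (sym (c′≡c u≢v)) (proj₂ (below ru<p))
        where
        ru<p : r u < p
        ru<p = ≤∧≢⇒< (s≤s⁻¹ ru<1+p) λ ru≡p → u≢v (r-inj (trans ru≡p (sym rv≡p)))
        c′≡c-before : ∀ {w} → r w < r u → c′ w ≡ c w
        c′≡c-before rw<ru = c′≡c λ { refl → <-irrefl rv≡p (<-trans rw<ru ru<p) }

    greedyBelow : ∀ r → Injective _≡_ _≡_ r → ∀ p → ∃ (GreedyBelow r p)
    greedyBelow r r-inj zero = (λ _ → 0) , λ ()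
    greedyBelow r r-inj (suc p) with greedyBelow r r-inj p | any? (λ v → r v ≟ⁿ p)
    ... | _ , below | yes (v , rv≡p) = greedyBelow-extend r-inj below rv≡p
    ... | c , below | no nobody =
      c , λ ru<1+p → below (≤∧≢⇒< (s≤s⁻¹ ru<1+p) λ ru≡p → nobody (_ , ru≡p))

  greedy-exists : ∀ r → Injective _≡_ _≡_ r → ∃ (IsGreedy r)
  greedy-exists r r-inj with bounded r
  ... | R , r<R with greedyBelow r r-inj R
  ...   | c , below = c , λ v → proj₁ (below (r<R v))

  greedy-color-attained : ∀ {r c} → IsGreedy r c → ∀ {v j} → j < c v → ∃ λ u → c u ≡ j
  greedy-color-attained greedy {v} {j} j<cv with CycleIn-other (proj₂ (greedy v) j j<cv) v
  ... | _ , inj₁ u≡v , u≢v = ⊥-elim (u≢v u≡v)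
  ... | u , inj₂ (_ , cu≡j) , _ = u , cu≡j

  greedy-≤-sorted-acyclic-coloring :
    ∀ {d r c} (w : V → Fin d) → IsAcyclicColoring D d w →
    (∀ {u v} → r u < r v → toℕ (w u) ≤ toℕ (w v)) → IsGreedy r c → ∀ v → c v ≤ toℕ (w v)
  greedy-≤-sorted-acyclic-coloring {r = r} {c} w acyclic sorted greedy = rank-induction r _ λ v IH →
    greedy-least (greedy v) (acyclic (w v) ∘ CycleIn-mono (same-class IH))
    where
    same-class : ∀ {v} → (∀ {u} → r u < r v → c u ≤ toℕ (w u)) →
                 Before r c v (toℕ (w v)) ⊆ λ u → w u ≡ w v
    same-class IH (inj₁ refl) = refl
    same-class IH (inj₂ (ru<rv , cu≡wv)) =
      toℕ-injective (≤-antisym (sorted ru<rv) (subst (_≤ _) cu≡wv (IH ru<rv)))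

  OrderAgrees : (r r′ : V → ℕ) → ℕ → Set
  OrderAgrees r r′ m = ∀ {v} → r′ v < m → ∀ u → r u < r v ⇔ r′ u < r′ v

  OrderAgrees-mono : ∀ {r r′ m m′} → m ≤ m′ → OrderAgrees r r′ m′ → OrderAgrees r r′ m
  OrderAgrees-mono m≤m′ agree r′v<m = agree (<-≤-trans r′v<m m≤m′)

  OrderAgrees-prefix : ∀ {r r′ m} → (∀ {u} → r′ u < m → r u ≡ r′ u) →
                       (∀ {u} → ¬ r′ u < m → m ≤ r u) → OrderAgrees r r′ m
  OrderAgrees-prefix {r} {r′} {m} same above {v} r′v<m u with r′ u <? m
  ... | yes r′u<m = mk⇔ (subst₂ _<_ (same r′u<m) (same r′v<m))
                        (subst₂ _<_ (sym (same r′u<m)) (sym (same r′v<m)))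
  ... | no r′u≮m = mk⇔ (λ ru<rv → ⊥-elim (<-irrefl refl (begin-strict
                          r v   ≡⟨ same r′v<m ⟩
                          r′ v  <⟨ r′v<m ⟩
                          m     ≤⟨ above r′u≮m ⟩
                          r u   <⟨ ru<rv ⟩
                          r v   ∎)))
                       (λ r′u<r′v → ⊥-elim (r′u≮m (<-trans r′u<r′v r′v<m)))
    where open ≤-Reasoning

  OrderAgrees-prefix-first : ∀ {r r′ m u v} → Injective _≡_ _≡_ r → OrderAgrees r r′ m →
                             r′ u < m → ¬ r′ v < m → r u < r v
  OrderAgrees-prefix-first {r} {u = u} {v} r-inj agree r′u<m r′v≮m with <-cmp (r u) (r v)
  ... | tri< ru<rv _ _ = ru<rv
  ... | tri≈ _ ru≡rv _ = ⊥-elim (r′v≮m (subst _ (r-inj ru≡rv) r′u<m))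
  ... | tri> _ _ rv<ru = ⊥-elim (r′v≮m (<-trans (to (agree r′u<m v) rv<ru) r′u<m))

  greedy-determined : ∀ {r c r′ c′ m} → OrderAgrees r r′ m → IsGreedy r c → IsGreedy r′ c′ →
                      ∀ {v} → r′ v < m → c v ≡ c′ v
  greedy-determined {r} {c} {r′} {c′} {m} agree greedy greedy′ {v} =
    rank-induction r′ (λ v → r′ v < m → c v ≡ c′ v) step v
    where
    step : ∀ v → (∀ {u} → r′ u < r′ v → r′ u < m → c u ≡ c′ u) → r′ v < m → c v ≡ c′ v
    step v IH r′v<m = ≤-antisym
      (greedy-least (greedy v) (proj₁ (greedy′ v) ∘ CycleIn-mono (Before-mono λ {u} _ ru<rv cu≡c′v →
         let r′u<r′v = to (agree r′v<m u) ru<rv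
         in r′u<r′v , trans (sym (IH r′u<r′v (<-trans r′u<r′v r′v<m))) cu≡c′v)))
      (greedy-least (greedy′ v) (proj₁ (greedy v) ∘ CycleIn-mono (Before-mono λ {u} _ r′u<r′v c′u≡cv →
         from (agree r′v<m u) r′u<r′v , trans (IH r′u<r′v (<-trans r′u<r′v r′v<m)) c′u≡cv)))

  greedy-from-digrundy : ∀ {k pos} {c : V → Fin k} → IsGreedyColoring D pos k c →
                         IsGreedy (toℕ ∘ pos) (toℕ ∘ c)
  greedy-from-digrundy {c = c} greedy v =
    proj₁ (greedy v) ∘ CycleIn-mono (Before-mono {c′ = c} λ _ pu<pv cu≡cv →
      pu<pv , toℕ-injective cu≡cv) ,
    λ j j<cv → CycleIn-mono (Before-mono {c = c} λ _ pu<pv cu≡j →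
                 pu<pv , trans (cong toℕ cu≡j) (toℕ-fromℕ< _))
                 (proj₂ (greedy v) (fromℕ< (<-trans j<cv (toℕ<n (c v))))
                   (subst (_< toℕ (c v)) (sym (toℕ-fromℕ< _)) j<cv))

  digrundy-from-greedy : ∀ {r c t} → Injective _≡_ _≡_ r → IsGreedy r c → (∀ u → c u ≤ t) →
                         (∃ λ v → c v ≡ t) → DigrundyColoring D (suc t)
  digrundy-from-greedy {r} {c} {t} r-inj greedy c≤t (v₀ , cv₀≡t) =
    pos , color , pos-injective , greedy′ , surjective
    where
    pos : V → V
    pos = proj₁ (compress r r-inj)
    pos-injective : Injective _≡_ _≡_ pos
    pos-injective = proj₁ (proj₂ (compress r r-inj))
    pos-order : ∀ {u v} → toℕ (pos u) < toℕ (pos v) ⇔ r u < r v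
    pos-order = proj₂ (proj₂ (compress r r-inj))

    color : V → Fin (suc t)
    color v = fromℕ< (s≤s (c≤t v))
    toℕ-color : ∀ v → toℕ (color v) ≡ c v
    toℕ-color v = toℕ-fromℕ< _

    greedy′ : IsGreedyColoring D pos (suc t) color
    greedy′ v =
      proj₁ (greedy v) ∘ CycleIn-mono (Before-mono λ {u} _ pu<pv cu≡cv →
        to pos-order pu<pv , trans (sym (toℕ-color u)) (trans (cong toℕ cu≡cv) (toℕ-color v))) ,
      λ i i<cv → CycleIn-mono (Before-mono λ {u} _ ru<rv cu≡i →
                   from pos-order ru<rv , toℕ-injective (trans (toℕ-color u) cu≡i))
                   (proj₂ (greedy v) (toℕ i) (subst (toℕ i <_) (toℕ-color v) i<cv))

    surjective : Surjective _≡_ _≡_ color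
    surjective i with toℕ i ≟ⁿ t
    ... | yes i≡t = v₀ , λ { refl → toℕ-injective (trans (toℕ-color v₀) (trans cv₀≡t (sym i≡t))) }
    ... | no i≢t with greedy-color-attained greedy {v₀}
                        (subst (toℕ i <_) (sym cv₀≡t) (≤∧≢⇒< (s≤s⁻¹ (toℕ<n i)) i≢t))
    ...   | u , cu≡i = u , λ { refl → toℕ-injective (trans (toℕ-color u) cu≡i) }

module Interpolation (D : Digraph) {g} (pos : Fin (n D) → Fin (n D)) (col : Fin (n D) → Fin g)
                     (pos-injective : Injective _≡_ _≡_ pos)
                     (col-greedy : IsGreedyColoring D pos g col)
                     (col-surjective : Surjective _≡_ _≡_ col) (t : ℕ) (t<g : t < g) where
  open Cycles D
  open Greedy D

  rπ cπ : V → ℕ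
  rπ = toℕ ∘ pos
  cπ = toℕ ∘ col

  rπ-injective : Injective _≡_ _≡_ rπ
  rπ-injective = pos-injective ∘ toℕ-injective

  π-greedy : IsGreedy rπ cπ
  π-greedy = greedy-from-digrundy col-greedy

  record State (m : ℕ) : Set where
    field
      rank : V → ℕ
      rank-injective : Injective _≡_ _≡_ rank
      color : V → ℕ
      greedy : IsGreedy rank color
      color≤t : ∀ u → color u ≤ t
      agrees : OrderAgrees rank rπ m

  initial : ∀ {d} (w : V → Fin d) → IsAcyclicColoring D d w → d ≤ suc t → State 0
  initial {d} w acyclic d≤1+t = record
    { rank = rank ; rank-injective = rank-injective ; color = proj₁ coloring
    ; greedy = proj₂ coloring ; color≤t = color≤t ; agrees = λ () }
    where
    rank : V → ℕ
    rank v = toℕ (w v) * n D + toℕ v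
    rank-injective : Injective _≡_ _≡_ rank
    rank-injective {u} {v} e =
      toℕ-injective (proj₂ (lex-injective (toℕ (w u)) (toℕ (w v)) (toℕ<n u) (toℕ<n v) e))
    coloring : ∃ (IsGreedy rank)
    coloring = greedy-exists rank rank-injective
    color≤t : ∀ v → proj₁ coloring v ≤ t
    color≤t v = s≤s⁻¹ (begin-strict
      proj₁ coloring v  ≤⟨ greedy-≤-sorted-acyclic-coloring w acyclic sorted (proj₂ coloring) v ⟩
      toℕ (w v)         <⟨ toℕ<n (w v) ⟩
      d                 ≤⟨ d≤1+t ⟩
      suc t             ∎)
      where
      open ≤-Reasoning
      sorted : ∀ {u v} → rank u < rank v → toℕ (w u) ≤ toℕ (w v)
      sorted {u} {v} ru<rv = lex-≤ (toℕ (w u)) (toℕ (w v)) (toℕ<n v) (<⇒≤ ru<rv)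

  module Advance {m} (A : State m) (color<t : ∀ u → State.color A u < t)
                 (x : V) (rπx≡m : rπ x ≡ m) where
    open State A using () renaming
      ( rank to rA; rank-injective to rA-injective; color to cA; greedy to greedyA
      ; agrees to agreesA )

    b : ℕ
    b = cπ x

    demote : ℕ → ℕ
    demote a with a ≟ⁿ b
    ... | yes _ = t
    ... | no _ = a

    demote-b : demote b ≡ t
    demote-b with b ≟ⁿ b
    ... | yes _ = refl
    ... | no b≢b = ⊥-elim (b≢b refl)

    demote-≤ : ∀ {a} → a < t → demote a ≤ t
    demote-≤ {a} a<t with a ≟ⁿ b
    ... | yes _ = ≤-refl
    ... | no _ = <⇒≤ a<t

    demote-<t : ∀ {a} → demote a < t → demote a ≡ a
    demote-<t {a} da<t with a ≟ⁿ b
    ... | yes _ = ⊥-elim (<-irrefl refl da<t)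
    ... | no _ = refl

    demote-injective : ∀ {a a′} → a < t → a′ < t → demote a ≡ demote a′ → a ≡ a′
    demote-injective {a} {a′} a<t a′<t e with a ≟ⁿ b | a′ ≟ⁿ b
    ... | yes a≡b | yes a′≡b = trans a≡b (sym a′≡b)
    ... | yes _ | no _ = ⊥-elim (<-irrefl (sym e) a′<t)
    ... | no _ | yes _ = ⊥-elim (<-irrefl e a<t)
    ... | no _ | no _ = e

    R : ℕ
    R = proj₁ (bounded rA)
    rA<R : ∀ u → rA u < R
    rA<R = proj₂ (bounded rA)

    -- lexicographic in (demote (cA u), rA u), since rA u < R
    key : V → ℕ
    key u = demote (cA u) * R + rA u

    data Zone (u : V) : Set where
      settled : rπ u < m → Zone u
      pivot   : u ≡ x → Zone u
      pending : ¬ rπ u < m → u ≢ x → Zone u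

    zone : ∀ u → Zone u
    zone u with rπ u <? m | u ≟ᶠ x
    ... | yes rπu<m | _ = settled rπu<m
    ... | no _ | yes u≡x = pivot u≡x
    ... | no rπu≮m | no u≢x = pending rπu≮m u≢x

    rankIn : ∀ u → Zone u → ℕ
    rankIn u (settled _) = rπ u
    rankIn u (pivot _) = m
    rankIn u (pending _ _) = suc (m + key u)

    rB : V → ℕ
    rB u = rankIn u (zone u)

    x-unsettled : ¬ rπ x < m
    x-unsettled = <-irrefl rπx≡m

    rB-zone : ∀ {u} (z : Zone u) → rB u ≡ rankIn u z
    rB-zone {u} z with zone u | z
    ... | settled _ | settled _ = refl
    ... | pivot _ | pivot _ = refl
    ... | pending _ _ | pending _ _ = refl
    ... | settled rπu<m | pivot refl = ⊥-elim (x-unsettled rπu<m)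
    ... | pivot refl | settled rπu<m = ⊥-elim (x-unsettled rπu<m)
    ... | settled rπu<m | pending rπu≮m _ = ⊥-elim (rπu≮m rπu<m)
    ... | pending rπu≮m _ | settled rπu<m = ⊥-elim (rπu≮m rπu<m)
    ... | pivot u≡x | pending _ u≢x = ⊥-elim (u≢x u≡x)
    ... | pending _ u≢x | pivot u≡x = ⊥-elim (u≢x u≡x)

    m<rB-pending : ∀ {u} → ¬ rπ u < m → u ≢ x → m < rB u
    m<rB-pending rπu≮m u≢x = subst (m <_) (sym (rB-zone (pending rπu≮m u≢x))) (s≤s (m≤m+n m _))

    rB-x : rB x ≡ m
    rB-x = rB-zone (pivot refl)

    rB-injective : Injective _≡_ _≡_ rB
    rB-injective {u} {v} e with zone u | zone v
    ... | settled _ | settled _ = rπ-injective e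
    ... | pivot u≡x | pivot v≡x = trans u≡x (sym v≡x)
    ... | pending _ _ | pending _ _ =
      rA-injective (proj₂ (lex-injective (demote (cA u)) (demote (cA v)) (rA<R u) (rA<R v)
                                         (+-cancelˡ-≡ m _ _ (suc-injective e))))
    ... | settled p | pivot _ = ⊥-elim (<-irrefl e p)
    ... | pivot _ | settled q = ⊥-elim (<-irrefl (sym e) q)
    ... | settled p | pending _ _ = ⊥-elim (<-irrefl e (<-trans p (s≤s (m≤m+n m _))))
    ... | pending _ _ | settled q = ⊥-elim (<-irrefl (sym e) (<-trans q (s≤s (m≤m+n m _))))
    ... | pivot _ | pending _ _ = ⊥-elim (<-irrefl e (s≤s (m≤m+n m _)))
    ... | pending _ _ | pivot _ = ⊥-elim (<-irrefl (sym e) (s≤s (m≤m+n m _)))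

    agreesB : OrderAgrees rB rπ (suc m)
    agreesB = OrderAgrees-prefix same above
      where
      same : ∀ {u} → rπ u < suc m → rB u ≡ rπ u
      same {u} rπu≤m with zone u
      ... | settled _ = refl
      ... | pivot refl = sym rπx≡m
      ... | pending rπu≮m u≢x =
        ⊥-elim (u≢x (rπ-injective (trans (≤∧≮⇒≡ (s≤s⁻¹ rπu≤m) rπu≮m) (sym rπx≡m))))
      above : ∀ {u} → ¬ rπ u < suc m → suc m ≤ rB u
      above {u} rπu≰m with zone u
      ... | settled p = ⊥-elim (rπu≰m (<-trans p (n<1+n m)))
      ... | pivot refl = ⊥-elim (rπu≰m (subst (_< suc m) (sym rπx≡m) (n<1+n m)))
      ... | pending _ _ = s≤s (m≤m+n m _)

    coloringB : ∃ (IsGreedy rB)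
    coloringB = greedy-exists rB rB-injective

    cB : V → ℕ
    cB = proj₁ coloringB

    greedyB : IsGreedy rB cB
    greedyB = proj₂ coloringB

    cB-settled : ∀ {u} → rπ u < m → cB u ≡ cA u
    cB-settled rπu<m =
      trans (greedy-determined (OrderAgrees-mono (n≤1+n m) agreesB) greedyB π-greedy rπu<m)
            (sym (greedy-determined agreesA greedyA π-greedy rπu<m))

    cB-x : cB x ≡ b
    cB-x = greedy-determined agreesB greedyB π-greedy (subst (_< suc m) (sym rπx≡m) (n<1+n m))

    settled-first : ∀ {u v} → rπ u < m → ¬ rπ v < m → rA u < rA v
    settled-first = OrderAgrees-prefix-first rA-injective agreesA

    b≤cA-x : b ≤ cA x
    b≤cA-x = subst (_≤ cA x) cB-x (greedy-least (greedyB x)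
      (proj₁ (greedyA x) ∘ CycleIn-mono (Before-mono λ {u} → by-zone (zone u))))
      where
      by-zone : ∀ {u} → Zone u → u ≢ x → rB u < rB x → cB u ≡ cA x → rA u < rA x × cA u ≡ cA x
      by-zone (settled rπu<m) _ _ cBu≡cAx =
        settled-first rπu<m x-unsettled , trans (sym (cB-settled rπu<m)) cBu≡cAx
      by-zone (pivot u≡x) u≢x _ _ = ⊥-elim (u≢x u≡x)
      by-zone (pending rπu≮m u≢x) _ rBu<rBx _ =
        ⊥-elim (<-asym (m<rB-pending rπu≮m u≢x) (subst (rB _ <_) rB-x rBu<rBx))

    b<t : b < t
    b<t = ≤-<-trans b≤cA-x (color<t x)

    pending-color : ∀ v → ¬ rπ v < m → v ≢ x → cB v ≤ demote (cA v)
    pending-color = rank-induction rB _ λ v IH rπv≮m v≢x → greedy-least (greedyB v)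
      (proj₁ (greedyA v) ∘ CycleIn-mono (Before-mono λ {u} _ → by-zone IH rπv≮m v≢x (zone u)))
      where
      by-zone : ∀ {u v} → (∀ {u} → rB u < rB v → ¬ rπ u < m → u ≢ x → cB u ≤ demote (cA u)) →
                ¬ rπ v < m → v ≢ x → Zone u →
                rB u < rB v → cB u ≡ demote (cA v) → rA u < rA v × cA u ≡ cA v
      by-zone {u} {v} _ rπv≮m _ (settled rπu<m) _ cBu≡dv =
        settled-first rπu<m rπv≮m ,
        trans cAu≡dv (demote-<t {cA v} (subst (_< t) cAu≡dv (color<t u)))
        where
        cAu≡dv : cA u ≡ demote (cA v)
        cAu≡dv = trans (sym (cB-settled rπu<m)) cBu≡dv
      by-zone {v = v} _ _ _ (pivot refl) _ cBx≡dv =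
        ⊥-elim (<-irrefl (trans b≡dv (trans (cong demote cAv≡b) demote-b)) b<t)
        where
        b≡dv : b ≡ demote (cA v)
        b≡dv = trans (sym cB-x) cBx≡dv
        cAv≡b : cA v ≡ b
        cAv≡b = trans (sym (demote-<t {cA v} (subst (_< t) b≡dv b<t))) (sym b≡dv)
      by-zone {u} {v} IH rπv≮m v≢x (pending rπu≮m u≢x) rBu<rBv cBu≡dv = rAu<rAv , cAu≡cAv
        where
        key< : key u < key v
        key< = +-cancelˡ-< m (key u) (key v) (s≤s⁻¹ (subst₂ _<_
                 (rB-zone (pending rπu≮m u≢x)) (rB-zone (pending rπv≮m v≢x)) rBu<rBv))
        du≡dv : demote (cA u) ≡ demote (cA v)
        du≡dv = ≤-antisym (lex-≤ (demote (cA u)) (demote (cA v)) (rA<R v) (<⇒≤ key<))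
                          (subst (_≤ demote (cA u)) cBu≡dv (IH rBu<rBv rπu≮m u≢x))
        cAu≡cAv : cA u ≡ cA v
        cAu≡cAv = demote-injective (color<t u) (color<t v) du≡dv
        rAu<rAv : rA u < rA v
        rAu<rAv = +-cancelˡ-< (demote (cA v) * R) (rA u) (rA v)
                    (subst (λ d → d * R + rA u < demote (cA v) * R + rA v) du≡dv key<)

    cB≤t : ∀ u → cB u ≤ t
    cB≤t u with zone u
    ... | settled rπu<m = subst (_≤ t) (sym (cB-settled rπu<m)) (<⇒≤ (color<t u))
    ... | pivot refl = subst (_≤ t) (sym cB-x) (<⇒≤ b<t)
    ... | pending rπu≮m u≢x = ≤-trans (pending-color u rπu≮m u≢x) (demote-≤ (color<t u))

    advanced : State (suc m)
    advanced = record
      { rank = rB ; rank-injective = rB-injective ; color = cB ; greedy = greedyB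
      ; color≤t = cB≤t ; agrees = agreesB }

  module _ {m} (A : State m) where
    open State A

    next : DigrundyColoring D (suc t) ⊎ State (suc m)
    next with any? (λ v → color v ≟ⁿ t)
    ... | yes attained = inj₁ (digrundy-from-greedy rank-injective greedy color≤t attained)
    ... | no unattained with any? (λ x → rπ x ≟ⁿ m)
    ...   | yes (x , rπx≡m) = inj₂ (Advance.advanced A color<t x rπx≡m)
      where
      color<t : ∀ u → color u < t
      color<t u = ≤∧≢⇒< (color≤t u) λ cu≡t → unattained (u , cu≡t)
    ...   | no vacant = inj₂ record
      { rank = rank ; rank-injective = rank-injective ; color = color ; greedy = greedy
      ; color≤t = color≤t
      ; agrees = λ rπv≤m → agrees (≤∧≢⇒< (s≤s⁻¹ rπv≤m) λ rπv≡m → vacant (_ , rπv≡m)) }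

  complete : State (n D) → DigrundyColoring D (suc t)
  complete A with col-surjective (fromℕ< t<g)
  ... | v , col-v≡t = digrundy-from-greedy rank-injective greedy color≤t (v , (begin
    color v              ≡⟨ greedy-determined agrees greedy π-greedy (toℕ<n (pos v)) ⟩
    toℕ (col v)          ≡⟨ cong toℕ (col-v≡t refl) ⟩
    toℕ (fromℕ< t<g)     ≡⟨ toℕ-fromℕ< t<g ⟩
    t                    ∎))
    where
    open State A
    open ≡-Reasoning

  interpolate : ∀ {d} (w : V → Fin d) → IsAcyclicColoring D d w → d ≤ suc t →
                DigrundyColoring D (suc t)
  interpolate w acyclic d≤1+t = [ id , complete ]′ (states (n D))
    where
    states : ∀ m → DigrundyColoring D (suc t) ⊎ State m
    states zero = inj₂ (initial w acyclic d≤1+t)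
    states (suc m) = [ inj₁ , next ]′ (states m)

digrundy-empty : ∀ D → (Fin (n D) → Fin 0) → DigrundyColoring D 0
digrundy-empty D empty = id , (⊥-elim ∘ ¬Fin0 ∘ empty) , id , (⊥-elim ∘ ¬Fin0 ∘ empty) , λ ()

mainTheorem2 : (D : Digraph) (d g k : ℕ) →
    IsDichromaticNumber D d → IsDigrundyNumber D g →
    d ≤ k → k ≤ g → DigrundyColoring D k
mainTheorem2 D d g zero ((w , _) , _) _ d≤0 _ = digrundy-empty D (subst Fin (n≤0⇒n≡0 d≤0) ∘ w)
mainTheorem2 D d g (suc t) ((w , acyclic) , _) ((pos , col , pos-inj , greedy , surj) , _) d≤k k≤g =
  Interpolation.interpolate D pos col pos-inj greedy surj t k≤g w acyclic d≤k
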